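{- Let $t,n\ge 1$ and $p\ge t+2$, and let $\mathfrak{P}$ be a set of $p$ posts. Let $\pi=(\alpha_1,\ldots,\alpha_w)$ be a valid sequence of configurations (of $t$ towers of $n$ disks on $\mathfrak{P}$), let $g\in\{1,\ldots,n\}$, and put $\mathbf{g}=(g,\ldots,g)\in\{1,\ldots,n\}^t$. (1) For every cluster $B$ of grading $\mathbf{g}$, the sequence $T_B(\pi)=(T_B(\alpha_1),\ldots,T_B(\alpha_w))$ is a valid sequence of configurations, and every configuration in it lies in $B$. (2) If there is a cluster $B$ of grading $(g-1,\ldots,g-1)$ containing every configuration of $\pi$, then for all posts $q,r\in\mathfrak{P}$ the sequence $\rho^{g}_{q,r}(\pi)=(\rho^{g}_{q,r}(\alpha_1),\ldots,\rho^{g}_{q,r}(\alpha_w))$ is a valid sequence of configurations, and every configuration in it lies in $B$.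
   Context: Setting (parallel Tower of Hanoi): there are $t$ towers (colors) of $n$ disks each and $p\ge t+2$ posts forming a set $\mathfrak{P}$. Disk $d_{u,j}$ ($u\in\{1,\ldots,t\}$, $j\in\{1,\ldots,n\}$) is the $j$-th largest disk of color $u$; smaller index means larger disk, and disks of the same index have equal size. A configuration is a $t\times n$ matrix $(a_{u,j})$ with entries in $\mathfrak{P}$, where $a_{u,j}$ is the post occupied by $d_{u,j}$, subject to no disk lying on a smaller or equal-sized disk, i.e. for each $j$ the entries $a_{1,j},\ldots,a_{t,j}$ are pairwise distinct (disks on a post are stacked by size). Adjacency: configurations $\alpha=(a_{u,j})$ and $\beta=(b_{u,j})$ are EREW-adjacent if (i) $a_{u,j}\ne b_{u,j}$ for at least one $(u,j)$, and (ii) whenever $a_{u,j}\ne b_{u,j}$, for all $v\in\{1,\ldots,t\}$ and all $y>j$ we have $a_{v,y}\ne a_{u,j}$ and $b_{v,y}\ne b_{u,j}$. A valid sequence of configurations is a finite sequence $(\alpha_1,\ldots,\alpha_w)$ in which each consecutive pair is either equal or EREW-adjacent. Clusters: for $\mathbf{g}=(g_1,\ldots,g_t)\in\{0,\ldots,n\}^t$, a cluster of grading $\mathbf{g}$ is the set of all configurations in which, for each $u$, the disks $d_{u,1},\ldots,d_{u,g_u}$ occupy prescribed fixed posts; the cluster of grading $(0,\ldots,0)$ is the set of all configurations. A sequence is contained in a cluster if all its configurations belong to it. Translative map: for $g\ge1$ and a cluster $B$ of grading $(g,\ldots,g)$ in which $d_{u,y}$ occupies post $b_{u,y}$ for $y\le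 g$, $T_B$ sends $\alpha=(a_{u,y})$ to the configuration whose $(u,y)$ entry is $b_{u,y}$ for $y\le g$ and $a_{u,y}$ for $y>g$. Reflective map: for $g\in\{1,\ldots,n\}$ and $q,r\in\mathfrak{P}$, $\rho^g_{q,r}$ sends $\alpha=(a_{u,y})$ to $(b_{u,y})$ where $b_{u,y}=a_{u,y}$ for $y<g$, and for $y\ge g$: $b_{u,y}=r$ if $a_{u,y}=q$, $b_{u,y}=q$ if $a_{u,y}=r$, and $b_{u,y}=a_{u,y}$ otherwise. -}

module Defs where

open import Data.Nat using (ℕ; zero; suc; _<_; _≤_)
open import Data.Fin using (Fin; toℕ; _≟_)
import Data.Fin as F
open import Data.Product using (_×_)
open import Data.Sum using (_⊎_)
open import Data.List using (List)
open import Data.List.Relation.Unary.All using (All)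
open import Data.List.Relation.Unary.Linked using (Linked)
open import Relation.Nullary using (¬_; yes; no)
open import Relation.Binary.PropositionalEquality using (_≡_; _≢_)
open import Data.Nat using (_<?_)

-- Colours u ∈ Fin t, disk indices j ∈ Fin n (0-based: index j is the paper's
-- disk number j+1; smaller index = larger disk), posts ∈ Fin p.
-- A "matrix" assigns to each disk d_{u,j} the post a_{u,j}.
Matrix : ℕ → ℕ → ℕ → Set
Matrix t n p = Fin t → Fin n → Fin p

IsConfig : ∀ {t n p} → Matrix t n p → Set
IsConfig {t} {n} a = ∀ (j : Fin n) (u v : Fin t) → a u j ≡ a v j → u ≡ v

SameConfig : ∀ {t n p} → Matrix t n p → Matrix t n p → Set
SameConfig a b = ∀ u j → a u j ≡ b u j

Adjacent : ∀ {t n p} → Matrix t n p → Matrix t n p → Set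
Adjacent {t} {n} a b =
  ¬ SameConfig a b ×
  (∀ (u : Fin t) (j : Fin n) → a u j ≢ b u j →
     ∀ (v : Fin t) (y : Fin n) → j F.< y → a v y ≢ a u j × b v y ≢ b u j)

Step : ∀ {t n p} → Matrix t n p → Matrix t n p → Set
Step a b = SameConfig a b ⊎ Adjacent a b

ValidSeq : ∀ {t n p} → List (Matrix t n p) → Set
ValidSeq π = All IsConfig π × Linked Step π

-- A cluster of grading gr : Fin t → ℕ, given by a representative configuration
-- whose disks d_{u,1},...,d_{u,gr u} fix the prescribed posts.
record Cluster (t n p : ℕ) (gr : Fin t → ℕ) : Set where
  constructor cluster
  field
    rep      : Matrix t n p
    repValid : IsConfig rep

-- Membership of a configuration in a cluster (disk d_{u,j} with paper index
-- toℕ j + 1 ≤ gr u must sit on the prescribed post).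
_∈C_ : ∀ {t n p gr} → Matrix t n p → Cluster t n p gr → Set
_∈C_ {t} {n} {p} {gr} a B =
  IsConfig a × (∀ (u : Fin t) (j : Fin n) → toℕ j < gr u → a u j ≡ Cluster.rep B u j)

constG : ∀ {t} → ℕ → Fin t → ℕ
constG g _ = g

translate : ∀ {t n p} (g : ℕ) → Cluster t n p (constG g) → Matrix t n p → Matrix t n p
translate g B a u y with toℕ y <? g
... | yes _ = Cluster.rep B u y
... | no  _ = a u y

swapPost : ∀ {p} → Fin p → Fin p → Fin p → Fin p
swapPost q r x with x ≟ q
... | yes _ = r
... | no  _ with x ≟ r
...   | yes _ = q
...   | no  _ = x

-- Reflective map ρ^g_{q,r}: disks with paper index y ≥ g (i.e. toℕ y + 1 ≥ g)
-- have posts q and r swapped; the others are unchanged.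
reflect : ∀ {t n p} (g : ℕ) → Fin p → Fin p → Matrix t n p → Matrix t n p
reflect g q r a u y with suc (toℕ y) <? g
... | yes _ = a u y
... | no  _ = swapPost q r (a u y)

-- Both maps act level by level with a threshold: on the levels of the large
-- disks the two ends of any step agree after the map, and on the remaining
-- levels posts are relabelled by an injection (the identity for T_B, the
-- transposition of q and r for ρ). A disk that moves in the image of a step is
-- therefore a small one that already moved in the original step, and the EREW
-- condition, being a statement about (in)equalities of posts, transfers through
-- the injective relabelling.
module Submission where

open import Defs
open import Data.Nat using (ℕ; _≤_; _+_; _∸_)
open import Data.Fin using (Fin)
open import Data.Product using (_×_)
open import Data.List using (List; map)
open import Data.List.Relation.Unary.All using (All)

open import Data.Nat using (suc; _<_; _<?_)
open import Data.Nat.Properties using (≤-trans; <⇒≤; ≮⇒≥; ≤⇒≯; ∸-monoˡ-≤)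
open import Data.Fin using (toℕ; _≟_)
import Data.Fin as Fin
open import Data.Fin.Properties using (all?)
open import Data.Product using (_,_)
open import Data.Sum using (inj₁; inj₂)
open import Data.List using ([]; _∷_)
open import Data.List.Relation.Unary.All using ([]; _∷_)
import Data.List.Relation.Unary.All as All
open import Data.List.Relation.Unary.All.Properties using (map⁺)
open import Data.List.Relation.Unary.Linked using (Linked; []; [-]; _∷_)
open import Function using (id)
open import Relation.Nullary using (Dec; yes; no; contradiction)
open import Relation.Binary.PropositionalEquality using (_≡_; _≢_; refl; sym; trans; cong)

Linked-map-within : ∀ {A B : Set} {P : A → Set} {R : A → A → Set} {S : B → B → Set}
  (f : A → B) → (∀ {x y} → P x → P y → R x y → S (f x) (f y)) →
  ∀ {xs} → All P xs → Linked R xs → Linked S (map f xs)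
Linked-map-within f pres _                []        = []
Linked-map-within f pres _                [-]       = [-]
Linked-map-within f pres (px ∷ py ∷ pxs) (r ∷ rs) =
  pres px py r ∷ Linked-map-within f pres (py ∷ pxs) rs

module _ {p : ℕ} (q r : Fin p) where

  swapPost-left : swapPost q r q ≡ r
  swapPost-left with q ≟ q
  ... | yes _  = refl
  ... | no q≢q = contradiction refl q≢q

  swapPost-right : swapPost q r r ≡ q
  swapPost-right with r ≟ q
  ... | yes r≡q = r≡q
  ... | no _ with r ≟ r
  ...   | yes _  = refl
  ...   | no r≢r = contradiction refl r≢r

  swapPost-other : ∀ {x} → x ≢ q → x ≢ r → swapPost q r x ≡ x
  swapPost-other {x} x≢q x≢r with x ≟ q
  ... | yes x≡q = contradiction x≡q x≢q
  ... | no _ with x ≟ r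
  ...   | yes x≡r = contradiction x≡r x≢r
  ...   | no _    = refl

swapPost-involutive : ∀ {p} (q r x : Fin p) → swapPost q r (swapPost q r x) ≡ x
swapPost-involutive q r x with x ≟ q
... | yes refl = swapPost-right x r
... | no x≢q with x ≟ r
...   | yes refl = swapPost-left q x
...   | no x≢r   = swapPost-other q r x≢q x≢r

swapPost-injective : ∀ {p} (q r : Fin p) {x y} → swapPost q r x ≡ swapPost q r y → x ≡ y
swapPost-injective q r {x} {y} e =
  trans (sym (swapPost-involutive q r x)) (trans (cong (swapPost q r) e) (swapPost-involutive q r y))

module _ {t n p : ℕ} where

  sameConfig? : (a b : Matrix t n p) → Dec (SameConfig a b)
  sameConfig? a b = all? λ u → all? λ j → a u j ≟ b u j

  map-validSeq : (P : Matrix t n p → Set) (f : Matrix t n p → Matrix t n p) →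
    (∀ {a} → P a → IsConfig (f a)) →
    (∀ {a b} → P a → P b → Step a b → Step (f a) (f b)) →
    ∀ {π} → All P π → Linked Step π → ValidSeq (map f π)
  map-validSeq P f config step ps steps =
    map⁺ (All.map config ps) , Linked-map-within f step ps steps

  module LevelwiseRelabelling
    (P : Matrix t n p → Set) (f : Matrix t n p → Matrix t n p)
    (k : ℕ) (σ : Fin p → Fin p) (σ-injective : ∀ {x y} → σ x ≡ σ y → x ≡ y)
    (agree-below : ∀ {a b} → P a → P b → ∀ u y → toℕ y < k → f a u y ≡ f b u y)
    (relabel-above : ∀ a u y → k ≤ toℕ y → f a u y ≡ σ (a u y))
    where

    relabel-≢ : ∀ a {u j v y} → k ≤ toℕ j → k ≤ toℕ y → a v y ≢ a u j → f a v y ≢ f a u j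
    relabel-≢ a {u} {j} {v} {y} k≤j k≤y a≢ e =
      a≢ (σ-injective (trans (sym (relabel-above a v y k≤y)) (trans e (relabel-above a u j k≤j))))

    step-preserved : ∀ {a b} → P a → P b → Step a b → Step (f a) (f b)
    step-preserved {a} {b} pa pb (inj₁ a≡b) = inj₁ same
      where
      same : SameConfig (f a) (f b)
      same u j with toℕ j <? k
      ... | yes j<k = agree-below pa pb u j j<k
      ... | no j≮k  = trans (relabel-above a u j (≮⇒≥ j≮k))
                        (trans (cong σ (a≡b u j)) (sym (relabel-above b u j (≮⇒≥ j≮k))))
    step-preserved {a} {b} pa pb (inj₂ (_ , erew)) with sameConfig? (f a) (f b)
    ... | yes same     = inj₁ same
    ... | no not-same  = inj₂ (not-same , erew′)
      where
      erew′ : ∀ u j → f a u j ≢ f b u j → ∀ v y → j Fin.< y →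
              f a v y ≢ f a u j × f b v y ≢ f b u j
      erew′ u j moved v y j<y with toℕ j <? k
      ... | yes j<k = contradiction (agree-below pa pb u j j<k) moved
      ... | no j≮k  =
        let k≤j = ≮⇒≥ j≮k
            k≤y = ≤-trans k≤j (<⇒≤ j<y)
            moved-before : a u j ≢ b u j
            moved-before e = moved (trans (relabel-above a u j k≤j)
                               (trans (cong σ e) (sym (relabel-above b u j k≤j))))
            (a≢ , b≢) = erew u j moved-before v y j<y
        in relabel-≢ a k≤j k≤y a≢ , relabel-≢ b k≤j k≤y b≢

  module _ (g : ℕ) (B : Cluster t n p (constG g)) where
    open Cluster B

    translate-below : ∀ {a u y} → toℕ y < g → translate g B a u y ≡ rep u y
    translate-below {y = y} y<g with toℕ y <? g
    ... | yes _   = refl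
    ... | no y≮g  = contradiction y<g y≮g

    translate-above : ∀ a u y → g ≤ toℕ y → translate g B a u y ≡ a u y
    translate-above a u y g≤y with toℕ y <? g
    ... | yes y<g = contradiction y<g (≤⇒≯ g≤y)
    ... | no _    = refl

    translate-isConfig : ∀ {a} → IsConfig a → IsConfig (translate g B a)
    translate-isConfig c j u v e with toℕ j <? g
    ... | yes _ = repValid j u v e
    ... | no _  = c j u v e

    translate-∈C : ∀ {a} → IsConfig a → translate g B a ∈C B
    translate-∈C c = translate-isConfig c , λ u j → translate-below

    translate-step : ∀ {a b} → IsConfig a → IsConfig b → Step a b →
                     Step (translate g B a) (translate g B b)
    translate-step = LevelwiseRelabelling.step-preserved IsConfig (translate g B) g id id
      (λ _ _ u y y<g → trans (translate-below y<g) (sym (translate-below y<g)))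
      translate-above

  module _ (g : ℕ) (q r : Fin p) where

    reflect-below : ∀ {a : Matrix t n p} {u y} → toℕ y < g ∸ 1 → reflect g q r a u y ≡ a u y
    reflect-below {y = y} y<g-1 with suc (toℕ y) <? g
    ... | yes _     = refl
    ... | no 1+y≮g  = contradiction y<g-1 (≤⇒≯ (∸-monoˡ-≤ 1 (≮⇒≥ 1+y≮g)))

    reflect-above : ∀ (a : Matrix t n p) u y → g ∸ 1 ≤ toℕ y → reflect g q r a u y ≡ swapPost q r (a u y)
    reflect-above a u y g-1≤y with suc (toℕ y) <? g
    ... | yes 1+y<g = contradiction (∸-monoˡ-≤ 1 1+y<g) (≤⇒≯ g-1≤y)
    ... | no _      = refl

    reflect-isConfig : ∀ {a : Matrix t n p} → IsConfig a → IsConfig (reflect g q r a)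
    reflect-isConfig c j u v e with suc (toℕ j) <? g
    ... | yes _ = c j u v e
    ... | no _  = c j u v (swapPost-injective q r e)

    module _ (B : Cluster t n p (constG (g ∸ 1))) where

      reflect-∈C : ∀ {a} → a ∈C B → reflect g q r a ∈C B
      reflect-∈C (c , fixed) =
        reflect-isConfig c , λ u j j<g-1 → trans (reflect-below j<g-1) (fixed u j j<g-1)

      reflect-step : ∀ {a b} → a ∈C B → b ∈C B → Step a b →
                     Step (reflect g q r a) (reflect g q r b)
      reflect-step = LevelwiseRelabelling.step-preserved (_∈C B) (reflect g q r) (g ∸ 1)
        (swapPost q r) (swapPost-injective q r)
        (λ (_ , fixed-a) (_ , fixed-b) u y y<g-1 →
           trans (reflect-below y<g-1) (trans (fixed-a u y y<g-1)
             (trans (sym (fixed-b u y y<g-1)) (sym (reflect-below y<g-1)))))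
        reflect-above

mainTheorem1 : (t n p : ℕ) → 1 ≤ t → 1 ≤ n → t + 2 ≤ p →
    (π : List (Matrix t n p)) → ValidSeq π →
    (g : ℕ) → 1 ≤ g → g ≤ n →
    ((B : Cluster t n p (constG g)) →
       ValidSeq (map (translate g B) π) × All (λ α → α ∈C B) (map (translate g B) π))
    ×
    ((B : Cluster t n p (constG (g ∸ 1))) → All (λ α → α ∈C B) π →
       (q r : Fin p) →
       ValidSeq (map (reflect g q r) π) × All (λ α → α ∈C B) (map (reflect g q r) π))
mainTheorem1 t n p _ _ _ π (configs , steps) g _ _ =
  (λ B → map-validSeq IsConfig (translate g B) (translate-isConfig g B) (translate-step g B)
                        configs steps
       , map⁺ (All.map (translate-∈C g B) configs))
  ,
  (λ B inB q r → map-validSeq (_∈C B) (reflect g q r) (λ (c , _) → reflect-isConfig g q r c)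
                   (reflect-step g q r B) inB steps
               , map⁺ (All.map (reflect-∈C g q r B) inB))
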